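{- If $\sigma^{(1)}\neq\sigma^{(2)}$ are two masks on the reduced word $\mathsf{w}$, then $p_{\sigma^{(1)}}\neq p_{\sigma^{(2)}}$.
   Context: Fix $n\ge2$, $w\in S_n$ and a reduced word $\mathsf{w}=\mathsf{w}_1\cdots\mathsf{w}_\ell$ for $w$, with $\mathsf{w}_j=s_{d_j}$ ($s_i$ the transposition of $i,i+1$); permutations are bijections of $\{1,\ldots,n\}$ multiplied by composition. A mask is $\sigma\in\{0,1\}^\ell$, and $\mathsf{w}^{\sigma[j]}=\mathsf{w}_1^{\sigma_1}\cdots\mathsf{w}_j^{\sigma_j}$ with $\mathsf{w}_i^1=\mathsf{w}_i$, $\mathsf{w}_i^0=1$. With $e_1,\ldots,e_n$ the standard basis of $\mathbb{C}^n$, $p_\sigma$ is the point $[V_1,\ldots,V_\ell]\in\mathrm{Gr}(d_1,n)\times\cdots\times\mathrm{Gr}(d_\ell,n)$ with $V_j=\mathrm{Span}(e_{\mathsf{w}^{\sigma[j]}(1)},\ldots,e_{\mathsf{w}^{\sigma[j]}(d_j)})$. -}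

module Defs where

open import Data.Nat using (ℕ; zero; suc; _≤_; _<_; _<?_)
open import Data.Fin using (Fin; zero; suc; inject₁; toℕ; _≟_)
open import Data.Fin.Subset using (Subset)
open import Data.Fin.Properties using (any?)
open import Data.Vec using (Vec; []; _∷_; tabulate)
open import Data.Bool using (Bool; true; false)
open import Data.Product using (_×_)
open import Relation.Nullary using (yes; no; does)
open import Relation.Nullary.Decidable using (_×-dec_)
open import Relation.Binary.PropositionalEquality using (_≡_)
open import Function using (_∘_; id)

-- Conventions: n = suc m, and {1,…,n} is represented by Fin (suc m) (0-based).
-- A letter i : Fin m stands for the simple transposition s_{toℕ i + 1},
-- swapping the (0-based) points inject₁ i and suc i.

Perm : ℕ → Set
Perm n = Fin n → Fin n

s : ∀ {m} → Fin m → Perm (suc m)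
s i x with x ≟ inject₁ i
... | yes _ = suc i
... | no _ with x ≟ suc i
...   | yes _ = inject₁ i
...   | no _ = x

dval : ∀ {m} → Fin m → ℕ
dval i = suc (toℕ i)

prod : ∀ {m ℓ} → Vec (Fin m) ℓ → Perm (suc m)
prod [] = id
prod (d ∷ ds) = s d ∘ prod ds

_≗ₚ_ : ∀ {n} → Perm n → Perm n → Set
f ≗ₚ g = ∀ x → f x ≡ g x

IsReducedWordFor : ∀ {m ℓ} → Perm (suc m) → Vec (Fin m) ℓ → Set
IsReducedWordFor {m} {ℓ} w word =
  (prod word ≗ₚ w) ×
  (∀ ℓ' (u : Vec (Fin m) ℓ') → prod u ≗ₚ w → ℓ ≤ ℓ')

letter : ∀ {m} → Fin m → Bool → Perm (suc m)
letter d true = s d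
letter d false = id

-- w^{σ[j]} = w₁^{σ₁} ⋯ w_j^{σ_j}, for j : Fin ℓ meaning position toℕ j + 1
prefix : ∀ {m ℓ} → Vec (Fin m) ℓ → Vec Bool ℓ → Fin ℓ → Perm (suc m)
prefix (d ∷ ds) (b ∷ bs) zero = letter d b
prefix (d ∷ ds) (b ∷ bs) (suc j) = letter d b ∘ prefix ds bs j

lookupW : ∀ {m ℓ} → Vec (Fin m) ℓ → Fin ℓ → Fin m
lookupW (d ∷ ds) zero = d
lookupW (d ∷ ds) (suc j) = lookupW ds j

-- coordinate subspace Span(e_{π(1)},…,e_{π(d)}), represented by its index set
-- {π(k) : k < d} ⊆ Fin (suc m)
coordSpan : ∀ {m} → Perm (suc m) → ℕ → Subset (suc m)
coordSpan π d = tabulate λ x → does (any? λ k → (toℕ k <? d) ×-dec (π k ≟ x))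

point : ∀ {m ℓ} → Vec (Fin m) ℓ → Vec Bool ℓ → Vec (Subset (suc m)) ℓ
point word σ = tabulate λ j → coordSpan (prefix word σ j) (dval (lookupW word j))

{-# OPTIONS --safe #-}
module Submission where

-- Let j be the first position where the masks differ.  Up to j the two prefixes are
-- g and g ∘ s_{d_j} for one permutation g, so for the first mask e_{g(d_j)} spans a
-- coordinate of V_j, while for the second g(d_j) is the image of d_j + 1 and
-- e_{g(d_j)} ∉ V_j.

open import Defs
open import Data.Nat using (ℕ; suc; _≤_; _<_; _<?_)
open import Data.Nat.Properties using (1+n≢n; n<1+n; <⇒≱; ≤-refl)
open import Data.Fin using (Fin; zero; suc; inject₁; toℕ; _≟_)
open import Data.Fin.Properties using (any?; toℕ-inject₁)
open import Data.Vec using (Vec; []; _∷_; lookup)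
open import Data.Vec.Properties using (lookup∘tabulate)
open import Data.Bool using (Bool; true; false) renaming (_≟_ to _≟ᵇ_)
open import Data.Product using (_,_; ∃)
open import Relation.Nullary using (Dec; yes; no; does; contradiction)
open import Relation.Nullary.Decidable using (dec-true; dec-false; _×-dec_)
open import Relation.Binary.PropositionalEquality
open import Function using (_∘_; id)
open import Function.Definitions using (Injective)
import Function.Construct.Composition as Compose

InjectivePerm : ∀ {n} → Perm n → Set
InjectivePerm = Injective _≡_ _≡_

suc≢inject₁ : ∀ {m} (i : Fin m) → suc i ≢ inject₁ i
suc≢inject₁ i eq = 1+n≢n (trans (cong toℕ eq) (toℕ-inject₁ i))

s-inject₁ : ∀ {m} (i : Fin m) → s i (inject₁ i) ≡ suc i
s-inject₁ i with inject₁ i ≟ inject₁ i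
... | yes _ = refl
... | no ≢ = contradiction refl ≢

s-suc : ∀ {m} (i : Fin m) → s i (suc i) ≡ inject₁ i
s-suc i with suc i ≟ inject₁ i
... | yes eq = contradiction eq (suc≢inject₁ i)
... | no _ with suc i ≟ suc i
...   | yes _ = refl
...   | no ≢ = contradiction refl ≢

s-fixes : ∀ {m} (i : Fin m) {x} → x ≢ inject₁ i → x ≢ suc i → s i x ≡ x
s-fixes i {x} x≢i x≢i+1 with x ≟ inject₁ i
... | yes eq = contradiction eq x≢i
... | no _ with x ≟ suc i
...   | yes eq = contradiction eq x≢i+1
...   | no _ = refl

s-involutive : ∀ {m} (i : Fin m) x → s i (s i x) ≡ x
s-involutive i x = by-cases (x ≟ inject₁ i) (x ≟ suc i)
  where
  by-cases : Dec (x ≡ inject₁ i) → Dec (x ≡ suc i) → s i (s i x) ≡ x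
  by-cases (yes refl) _ = trans (cong (s i) (s-inject₁ i)) (s-suc i)
  by-cases (no _) (yes refl) = trans (cong (s i) (s-suc i)) (s-inject₁ i)
  by-cases (no x≢i) (no x≢i+1) =
    trans (cong (s i) (s-fixes i x≢i x≢i+1)) (s-fixes i x≢i x≢i+1)

s-injective : ∀ {m} (i : Fin m) → InjectivePerm (s i)
s-injective i {x} {y} eq =
  trans (sym (s-involutive i x)) (trans (cong (s i) eq) (s-involutive i y))

s⁻¹-inject₁ : ∀ {m} (i : Fin m) {k} → s i k ≡ inject₁ i → k ≡ suc i
s⁻¹-inject₁ i eq = s-injective i (trans eq (sym (s-suc i)))

lookup-coordSpan : ∀ {m} (π : Perm (suc m)) d x →
  lookup (coordSpan π d) x ≡ does (any? λ k → (toℕ k <? d) ×-dec (π k ≟ x))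
lookup-coordSpan π d = lookup∘tabulate λ x → does (any? λ k → (toℕ k <? d) ×-dec (π k ≟ x))

coordSpan-∋ : ∀ {m} (π : Perm (suc m)) d {k} → toℕ k < d → lookup (coordSpan π d) (π k) ≡ true
coordSpan-∋ π d {k} k<d = trans (lookup-coordSpan π d (π k))
  (dec-true (any? λ k′ → (toℕ k′ <? d) ×-dec (π k′ ≟ π k)) (k , k<d , refl))

coordSpan-∌ : ∀ {m} (π : Perm (suc m)) d x → (∀ k → π k ≡ x → d ≤ toℕ k) →
  lookup (coordSpan π d) x ≡ false
coordSpan-∌ π d x late = trans (lookup-coordSpan π d x)
  (dec-false (any? λ k → (toℕ k <? d) ×-dec (π k ≟ x))
    λ { (k , k<d , πk≡x) → <⇒≱ k<d (late k πk≡x) })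

coordSpan-∘s-≢ : ∀ {m} (g : Perm (suc m)) → InjectivePerm g → (i : Fin m) →
  coordSpan g (dval i) ≢ coordSpan (g ∘ s i) (dval i)
coordSpan-∘s-≢ g g-inj i eq =
  true≢false (trans (sym in-g) (trans (cong (λ V → lookup V x) eq) notin-g∘s))
  where
  x = g (inject₁ i)
  true≢false : true ≢ false
  true≢false ()
  in-g : lookup (coordSpan g (dval i)) x ≡ true
  in-g = coordSpan-∋ g (dval i) (subst (_< dval i) (sym (toℕ-inject₁ i)) (n<1+n (toℕ i)))
  notin-g∘s : lookup (coordSpan (g ∘ s i) (dval i)) x ≡ false
  notin-g∘s = coordSpan-∌ (g ∘ s i) (dval i) x
    λ k gsk≡x → subst (λ k → dval i ≤ toℕ k) (sym (s⁻¹-inject₁ i (g-inj gsk≡x))) ≤-refl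

letter-injective : ∀ {m} (d : Fin m) b → InjectivePerm (letter d b)
letter-injective d true = s-injective d
letter-injective d false = id

letterSpans-≢ : ∀ {m} (f : Perm (suc m)) → InjectivePerm f → (d : Fin m) {b₁ b₂ : Bool} →
  b₁ ≢ b₂ → coordSpan (f ∘ letter d b₁) (dval d) ≢ coordSpan (f ∘ letter d b₂) (dval d)
letterSpans-≢ f f-inj d {false} {true} _ = coordSpan-∘s-≢ f f-inj d
letterSpans-≢ f f-inj d {true} {false} _ = coordSpan-∘s-≢ f f-inj d ∘ sym
letterSpans-≢ f f-inj d {false} {false} b₁≢b₂ = contradiction refl b₁≢b₂
letterSpans-≢ f f-inj d {true} {true} b₁≢b₂ = contradiction refl b₁≢b₂

prefixSpans-≢ : ∀ {m ℓ} (f : Perm (suc m)) → InjectivePerm f →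
  (word : Vec (Fin m) ℓ) (σ₁ σ₂ : Vec Bool ℓ) → σ₁ ≢ σ₂ →
  ∃ λ j → coordSpan (f ∘ prefix word σ₁ j) (dval (lookupW word j))
        ≢ coordSpan (f ∘ prefix word σ₂ j) (dval (lookupW word j))
prefixSpans-≢ f f-inj [] [] [] σ₁≢σ₂ = contradiction refl σ₁≢σ₂
prefixSpans-≢ f f-inj (d ∷ ds) (b₁ ∷ bs₁) (b₂ ∷ bs₂) σ₁≢σ₂ with b₁ ≟ᵇ b₂
... | no b₁≢b₂ = zero , letterSpans-≢ f f-inj d b₁≢b₂
... | yes refl
  with j , V≢ ← prefixSpans-≢ (f ∘ letter d b₁)
                  (Compose.injective _≡_ _≡_ _≡_ (letter-injective d b₁) f-inj)
                  ds bs₁ bs₂ (σ₁≢σ₂ ∘ cong (b₁ ∷_))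
  = suc j , V≢

lookup-point : ∀ {m ℓ} (word : Vec (Fin m) ℓ) σ j →
  lookup (point word σ) j ≡ coordSpan (prefix word σ j) (dval (lookupW word j))
lookup-point word σ = lookup∘tabulate _

proposition5p5 : (m : ℕ) → 2 ≤ suc m → (w : Perm (suc m)) → (ℓ : ℕ) → (word : Vec (Fin m) ℓ)
    → IsReducedWordFor w word
    → (σ₁ σ₂ : Vec Bool ℓ) → σ₁ ≢ σ₂ → point word σ₁ ≢ point word σ₂
proposition5p5 m _ w ℓ word _ σ₁ σ₂ σ₁≢σ₂ p₁≡p₂
  with j , V≢ ← prefixSpans-≢ id id word σ₁ σ₂ σ₁≢σ₂
  = V≢ (begin
    coordSpan (prefix word σ₁ j) (dval (lookupW word j)) ≡⟨ lookup-point word σ₁ j ⟨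
    lookup (point word σ₁) j                             ≡⟨ cong (λ p → lookup p j) p₁≡p₂ ⟩
    lookup (point word σ₂) j                             ≡⟨ lookup-point word σ₂ j ⟩
    coordSpan (prefix word σ₂ j) (dval (lookupW word j)) ∎)
  where open ≡-Reasoning
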